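{- Let $G$ be a graph and $\ell$ an integer. Suppose $u, v, w$ are pairwise adjacent vertices of $G$ with $\deg(u) = \deg(w) = 2$. Then $G$ has an induced matching of size $\ell$ if and only if $G - v$ has an induced matching of size $\ell$.
   Context: All graphs are finite, simple and undirected. A matching $M$ in $G$ is an induced matching if no edge of $G$ joins endpoints of two distinct edges of $M$. $G - v$ is the graph obtained by deleting $v$. -}

module Defs where

open import Data.Nat using (ℕ; suc)
open import Data.Fin using (Fin; punchIn)
open import Data.Bool using (Bool; true; false; T)
open import Data.Bool.Properties using (T?)
open import Data.List using (length; filter; allFin)
open import Data.Sum using (_⊎_)
open import Data.Product using (Σ; _×_; _,_; proj₁; proj₂)
open import Relation.Binary.PropositionalEquality using (_≡_; _≢_)

record Graph (n : ℕ) : Set where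
  field
    adj   : Fin n → Fin n → Bool
    sym   : ∀ x y → adj x y ≡ adj y x
    irrefl : ∀ x → adj x x ≡ false
open Graph public

deg : ∀ {n} → Graph n → Fin n → ℕ
deg {n} G v = length (filter (λ u → T? (adj G v u)) (allFin n))

delete : ∀ {n} → (G : Graph (suc n)) → Fin (suc n) → Graph n
delete G v = record
  { adj = λ x y → adj G (punchIn v x) (punchIn v y)
  ; sym = λ x y → sym G (punchIn v x) (punchIn v y)
  ; irrefl = λ x → irrefl G (punchIn v x)
  }

-- an induced matching of size ℓ: ℓ edges indexed by Fin ℓ such that each is an
-- edge of G and for distinct indices i ≢ j, any endpoint of edge i and any endpoint
-- of edge j are distinct and non-adjacent (so the edges are pairwise disjoint,
-- distinct, and no edge of G joins two of them).
record InducedMatching {n} (G : Graph n) (ℓ : ℕ) : Set where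
  field
    edge      : Fin ℓ → Fin n × Fin n
    isEdge    : ∀ i → adj G (proj₁ (edge i)) (proj₂ (edge i)) ≡ true
    separated : ∀ i j → i ≢ j →
      ∀ x y → (x ≡ proj₁ (edge i) ⊎ x ≡ proj₂ (edge i)) →
              (y ≡ proj₁ (edge j) ⊎ y ≡ proj₂ (edge j)) →
              (x ≢ y) × (adj G x y ≡ false)

-- Since deg u = deg w = 2, the neighbourhoods of u and w lie inside the closed
-- neighbourhood of v. At most one edge of an induced matching meets v; replacing it
-- by uw keeps the matching induced, because every vertex separated from v is then
-- separated from u and w as well. Hence G has an induced matching of size ℓ avoiding v
-- whenever it has one at all, and those avoiding v are the induced matchings of G - v.
module Submission where

open import Defs hiding (sym)
open import Data.Nat using (ℕ; suc)
open import Data.Fin using (Fin; punchIn; punchOut; _≟_)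
open import Data.Fin.Properties using (punchIn-punchOut; punchIn-injective)
open import Data.Bool using (true; false)
open import Data.Bool.Properties using (T?; T-≡; ¬-not)
open import Data.List using (List; []; _∷_; length; filter; allFin)
open import Data.List.Relation.Unary.Any using (here; there)
open import Data.List.Membership.Propositional using (_∈_)
open import Data.List.Membership.Propositional.Properties using (∈-filter⁺; ∈-allFin)
open import Data.Sum using (_⊎_; inj₁; inj₂; [_,_])
open import Data.Product using (∃; _×_; _,_; proj₁; proj₂; map)
open import Function using (_∘_)
open import Function.Bundles using (Equivalence)
open import Function.Definitions using (Injective)
open import Relation.Nullary using (Dec; ¬_; yes; no; contradiction)
open import Relation.Nullary.Decidable using (_⊎-dec_)
open import Relation.Binary.PropositionalEquality using (_≡_; _≢_; refl; sym; trans; cong; cong₂; subst)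

infix 4 _∈ₑ_ _∈ₑ?_

_∈ₑ_ : ∀ {n} → Fin n → Fin n × Fin n → Set
x ∈ₑ (a , b) = x ≡ a ⊎ x ≡ b

_∈ₑ?_ : ∀ {n} (x : Fin n) (e : Fin n × Fin n) → Dec (x ∈ₑ e)
x ∈ₑ? (a , b) = (x ≟ a) ⊎-dec (x ≟ b)

∈ₑ-map⁺ : ∀ {m n} (f : Fin m → Fin n) {x e} → x ∈ₑ e → f x ∈ₑ map f f e
∈ₑ-map⁺ f (inj₁ refl) = inj₁ refl
∈ₑ-map⁺ f (inj₂ refl) = inj₂ refl

∈ₑ-map⁻ : ∀ {m n} (f : Fin m → Fin n) {y e} → y ∈ₑ map f f e → ∃ λ x → x ∈ₑ e × f x ≡ y
∈ₑ-map⁻ f (inj₁ refl) = _ , inj₁ refl , refl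
∈ₑ-map⁻ f (inj₂ refl) = _ , inj₂ refl , refl

adj-sym : ∀ {n} (G : Graph n) {x y} → adj G x y ≡ true → adj G y x ≡ true
adj-sym G xy = trans (Graph.sym G _ _) xy

adjacent⇒≢ : ∀ {n} (G : Graph n) {x y} → adj G x y ≡ true → x ≢ y
adjacent⇒≢ G {x} xy refl with () ← trans (sym xy) (irrefl G x)

Separated : ∀ {n} → Graph n → Fin n → Fin n → Set
Separated G x y = x ≢ y × adj G x y ≡ false

separated-sym : ∀ {n} (G : Graph n) {x y} → Separated G x y → Separated G y x
separated-sym G (x≢y , xy) = x≢y ∘ sym , trans (Graph.sym G _ _) xy

module _ {m n} {H : Graph m} {G : Graph n} (f : Fin m → Fin n)
         (adj-f : ∀ x y → adj G (f x) (f y) ≡ adj H x y) where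

  pushMatching : Injective _≡_ _≡_ f → ∀ {ℓ} → InducedMatching H ℓ → InducedMatching G ℓ
  pushMatching f-inj M = record
    { edge      = map f f ∘ edge
    ; isEdge    = λ i → trans (adj-f _ _) (isEdge i)
    ; separated = separated′
    }
    where
    open InducedMatching M
    separated′ : ∀ i j → i ≢ j → ∀ x y → x ∈ₑ map f f (edge i) → y ∈ₑ map f f (edge j) →
                 Separated G x y
    separated′ i j i≢j x y x∈ y∈ with ∈ₑ-map⁻ f x∈ | ∈ₑ-map⁻ f y∈
    ... | a , a∈ , refl | b , b∈ , refl =
      let a≢b , ab = separated i j i≢j a b a∈ b∈ in a≢b ∘ f-inj , trans (adj-f a b) ab

  pullMatching : ∀ {ℓ} (M : InducedMatching G ℓ) (e : Fin ℓ → Fin m × Fin m) →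
                 (∀ i → InducedMatching.edge M i ≡ map f f (e i)) → InducedMatching H ℓ
  pullMatching M e edge≡ = record
    { edge      = e
    ; isEdge    = λ i → trans (sym (adj-f _ _))
                    (subst (λ p → adj G (proj₁ p) (proj₂ p) ≡ true) (edge≡ i) (isEdge i))
    ; separated = separated′
    }
    where
    open InducedMatching M
    lift : ∀ i {x} → x ∈ₑ e i → f x ∈ₑ edge i
    lift i x∈ = subst (_ ∈ₑ_) (sym (edge≡ i)) (∈ₑ-map⁺ f x∈)
    separated′ : ∀ i j → i ≢ j → ∀ x y → x ∈ₑ e i → y ∈ₑ e j → Separated H x y
    separated′ i j i≢j x y x∈ y∈ =
      let fx≢fy , fxfy = separated i j i≢j (f x) (f y) (lift i x∈) (lift j y∈)
      in fx≢fy ∘ cong f , trans (sym (adj-f x y)) fxfy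

Avoids : ∀ {n ℓ} {G : Graph n} → InducedMatching G ℓ → Fin n → Set
Avoids M v = ∀ i → ¬ v ∈ₑ InducedMatching.edge M i

deleteMatching⁺ : ∀ {n ℓ} (G : Graph (suc n)) v → InducedMatching (delete G v) ℓ → InducedMatching G ℓ
deleteMatching⁺ G v = pushMatching (punchIn v) (λ _ _ → refl) (punchIn-injective v _ _)

deleteMatching⁻ : ∀ {n ℓ} (G : Graph (suc n)) v (M : InducedMatching G ℓ) → Avoids M v →
                  InducedMatching (delete G v) ℓ
deleteMatching⁻ {n} {ℓ} G v M v∉ = pullMatching (punchIn v) (λ _ _ → refl) M lower punchIn-lower
  where
  lower : Fin ℓ → Fin n × Fin n
  lower i = punchOut (v∉ i ∘ inj₁) , punchOut (v∉ i ∘ inj₂)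
  punchIn-lower : ∀ i → InducedMatching.edge M i ≡ map (punchIn v) (punchIn v) (lower i)
  punchIn-lower i = sym (cong₂ _,_ (punchIn-punchOut _) (punchIn-punchOut _))

-- N(x) ⊆ N[v]; for x adjacent to v this is the usual domination N[x] ⊆ N[v].
Dominates : ∀ {n} → Graph n → Fin n → Fin n → Set
Dominates G v x = ∀ y → adj G x y ≡ true → y ≡ v ⊎ adj G v y ≡ true

dominated-separated : ∀ {n} (G : Graph n) {v x y} → adj G v x ≡ true → Dominates G v x →
                      Separated G v y → Separated G x y
dominated-separated G {v} {x} {y} vx v≽x (v≢y , vy) = x≢y , ¬-not ¬xy
  where
  x≢y : x ≢ y
  x≢y refl with () ← trans (sym vx) vy
  ¬xy : adj G x y ≢ true
  ¬xy xy with v≽x y xy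
  ... | inj₁ y≡v = v≢y (sym y≡v)
  ... | inj₂ vy′ with () ← trans (sym vy′) vy

module Replacement {n} (G : Graph n) {u v w : Fin n}
         (uw : adj G u w ≡ true) (vu : adj G v u ≡ true) (vw : adj G v w ≡ true)
         (v≽u : Dominates G v u) (v≽w : Dominates G v w) where

  replaceEdge : Fin n × Fin n → Fin n × Fin n
  replaceEdge e with v ∈ₑ? e
  ... | yes _ = u , w
  ... | no _  = e

  replaceEdge-avoids : ∀ e → ¬ v ∈ₑ replaceEdge e
  replaceEdge-avoids e with v ∈ₑ? e
  ... | yes _   = [ adjacent⇒≢ G vu , adjacent⇒≢ G vw ]
  ... | no v∉e = v∉e

  replacement-separated : ∀ {x y} → x ∈ₑ (u , w) → Separated G v y → Separated G x y
  replacement-separated (inj₁ refl) = dominated-separated G vu v≽u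
  replacement-separated (inj₂ refl) = dominated-separated G vw v≽w

  replaceMatching : ∀ {ℓ} → InducedMatching G ℓ → InducedMatching G ℓ
  replaceMatching {ℓ} M = record
    { edge      = replaceEdge ∘ edge
    ; isEdge    = isEdge′
    ; separated = separated′
    }
    where
    open InducedMatching M
    isEdge′ : ∀ i → adj G (proj₁ (replaceEdge (edge i))) (proj₂ (replaceEdge (edge i))) ≡ true
    isEdge′ i with v ∈ₑ? edge i
    ... | yes _ = uw
    ... | no _  = isEdge i
    separated′ : ∀ i j → i ≢ j → ∀ x y → x ∈ₑ replaceEdge (edge i) → y ∈ₑ replaceEdge (edge j) →
                 Separated G x y
    separated′ i j i≢j x y x∈ y∈ with v ∈ₑ? edge i | v ∈ₑ? edge j
    ... | no _    | no _    = separated i j i≢j x y x∈ y∈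
    ... | yes v∈i | no _    = replacement-separated x∈ (separated i j i≢j v y v∈i y∈)
    ... | no _    | yes v∈j = separated-sym G
      (replacement-separated y∈ (separated-sym G (separated i j i≢j x v x∈ v∈j)))
    ... | yes v∈i | yes v∈j = contradiction refl (proj₁ (separated i j i≢j v v v∈i v∈j))

  replaceMatching-avoids : ∀ {ℓ} (M : InducedMatching G ℓ) → Avoids (replaceMatching M) v
  replaceMatching-avoids M i = replaceEdge-avoids (InducedMatching.edge M i)

two-distinct-exhaust : ∀ {A : Set} (xs : List A) {a b y : A} → length xs ≡ 2 →
                       a ∈ xs → b ∈ xs → a ≢ b → y ∈ xs → y ≡ a ⊎ y ≡ b
two-distinct-exhaust (c ∷ d ∷ []) refl (here refl) (here refl) a≢b _ = contradiction refl a≢b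
two-distinct-exhaust (c ∷ d ∷ []) refl (there (here refl)) (there (here refl)) a≢b _ =
  contradiction refl a≢b
two-distinct-exhaust (c ∷ d ∷ []) refl (here refl) (there (here refl)) _ (here refl) = inj₁ refl
two-distinct-exhaust (c ∷ d ∷ []) refl (here refl) (there (here refl)) _ (there (here refl)) =
  inj₂ refl
two-distinct-exhaust (c ∷ d ∷ []) refl (there (here refl)) (here refl) _ (here refl) = inj₂ refl
two-distinct-exhaust (c ∷ d ∷ []) refl (there (here refl)) (here refl) _ (there (here refl)) =
  inj₁ refl

degree-two-neighbours : ∀ {n} (G : Graph n) {x a b y} → deg G x ≡ 2 →
                        adj G x a ≡ true → adj G x b ≡ true → a ≢ b →
                        adj G x y ≡ true → y ≡ a ⊎ y ≡ b
degree-two-neighbours {n} G {x} d xa xb a≢b xy =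
  two-distinct-exhaust _ d (neighbour xa) (neighbour xb) a≢b (neighbour xy)
  where
  neighbour : ∀ {z} → adj G x z ≡ true → z ∈ filter (λ z → T? (adj G x z)) (allFin n)
  neighbour xz = ∈-filter⁺ (λ z → T? (adj G x z)) (∈-allFin _) (Equivalence.from T-≡ xz)

triangle-dominates : ∀ {n} (G : Graph n) {x v w} → deg G x ≡ 2 →
                     adj G x v ≡ true → adj G x w ≡ true → adj G v w ≡ true → Dominates G v x
triangle-dominates G d xv xw vw y xy with degree-two-neighbours G d xv xw (adjacent⇒≢ G vw) xy
... | inj₁ y≡v = inj₁ y≡v
... | inj₂ refl = inj₂ vw

lemma2 : ∀ {n} (G : Graph (suc n)) (ℓ : ℕ) (u v w : Fin (suc n)) →
    adj G u v ≡ true → adj G v w ≡ true → adj G u w ≡ true →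
    deg G u ≡ 2 → deg G w ≡ 2 →
    (InducedMatching G ℓ → InducedMatching (delete G v) ℓ) ×
    (InducedMatching (delete G v) ℓ → InducedMatching G ℓ)
lemma2 G ℓ u v w uv vw uw du dw = avoidingMatching , deleteMatching⁺ G v
  where
  vu : adj G v u ≡ true
  vu = adj-sym G uv
  v≽u : Dominates G v u
  v≽u = triangle-dominates G du uv uw vw
  v≽w : Dominates G v w
  v≽w = triangle-dominates G dw (adj-sym G vw) (adj-sym G uw) vu
  open Replacement G uw vu vw v≽u v≽w
  avoidingMatching : InducedMatching G ℓ → InducedMatching (delete G v) ℓ
  avoidingMatching M = deleteMatching⁻ G v (replaceMatching M) (replaceMatching-avoids M)
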